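{- Let $Z_1$ and $Z_2$ be two graphs and let $\mathfrak{F}^1$ and $\mathfrak{F}^2$ be obstructing sets for $\mathrm{apex}_{\mathrm{excl}(Z_1)}$ and $\mathrm{apex}_{\mathrm{excl}(Z_2)}$ respectively, both with gap function $f$. Then $\mathsf{p}_{\mathfrak{F}^1\otimes\mathfrak{F}^2}\preceq\mathrm{apex}_{\mathrm{excl}(Z_1+Z_2)}$.
   Context: All graphs are finite and simple; $\le$ denotes the minor relation. For a graph $Z$, $\mathrm{excl}(Z)$ is the class of graphs not containing $Z$ as a minor, and $\mathrm{apex}_{\mathrm{excl}(Z)}(G)$ is the minimum size of a set $S\subseteq V(G)$ such that $G-S\in\mathrm{excl}(Z)$. $Z_1+Z_2$ denotes the disjoint union. A graph parameter is a function from graphs to $\mathbb{N}$; for parameters $\mathsf{p},\mathsf{q}$, $\mathsf{p}\preceq\mathsf{q}$ means there is $g:\mathbb{N}\to\mathbb{N}$ with $\mathsf{p}(G)\le g(\mathsf{q}(G))$ for all $G$; $\mathsf{p}$ and $\mathsf{q}$ are equivalent with gap function $f$ if $\mathsf{p}(G)\le f(\mathsf{q}(G))$ and $\mathsf{q}(G)\le f(\mathsf{p}(G))$ for all $G$. A parametric graph is a sequence $\mathcal{G}=\langle\mathcal{G}_t\rangle_{t\in\mathbb{N}}$ of graphs with $\mathcal{G}_t\le\mathcal{G}_{t+1}$ for all $t$; a parametric family is a set of parametric graphs. For a parametric graph $\mathcal{G}$, $\mathsf{p}_{\mathcal{G}}(G)=\max\{t:\mathcal{G}_t\le G\}$, and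 for a parametric family $\mathfrak{G}$, $\mathsf{p}_{\mathfrak{G}}(G)=\max\{\mathsf{p}_{\mathcal{G}}(G):\mathcal{G}\in\mathfrak{G}\}$. A parametric family $\mathfrak{G}$ is an obstructing set for a parameter $\mathsf{p}$ with gap function $f$ if $\mathsf{p}$ and $\mathsf{p}_{\mathfrak{G}}$ are equivalent with gap function $f$. For parametric graphs $\mathcal{G}^1,\mathcal{G}^2$, $\mathcal{G}^1+\mathcal{G}^2=\langle\mathcal{G}^1_t+\mathcal{G}^2_t\rangle_{t\in\mathbb{N}}$, and for parametric families $\mathfrak{G}^1\otimes\mathfrak{G}^2=\{\mathcal{G}^1+\mathcal{G}^2:\mathcal{G}^1\in\mathfrak{G}^1,\mathcal{G}^2\in\mathfrak{G}^2\}$. -}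

module Defs where

open import Data.Nat using (ℕ; zero; suc; _+_; _≤_)
open import Data.Fin using (Fin; zero; suc; splitAt; _↑ˡ_; _↑ʳ_)
open import Data.Fin.Properties using (splitAt-↑ˡ; splitAt-↑ʳ; splitAt⁻¹-↑ˡ; splitAt⁻¹-↑ʳ)
open import Data.Fin.Subset using (Subset; ∣_∣; ∁)
open import Data.Vec using (Vec; []; _∷_)
open import Data.Bool using (Bool; true; false)
open import Data.Sum using (_⊎_; inj₁; inj₂)
open import Data.Sum.Properties using (inj₁-injective; inj₂-injective)
open import Data.Product using (Σ; ∃; ∃₂; _×_; _,_)
open import Data.Empty using (⊥; ⊥-elim)
open import Relation.Nullary using (¬_)
open import Relation.Binary.PropositionalEquality
  using (_≡_; refl; sym; trans; cong; subst)

record Graph : Set where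
  field
    n   : ℕ
    adj : Fin n → Fin n → Bool
    sym-adj : ∀ x y → adj x y ≡ adj y x
    irr-adj : ∀ x → adj x x ≡ false
open Graph public

data Path (G : Graph) (P : Fin (n G) → Set) : Fin (n G) → Fin (n G) → Set where
  here : ∀ {x} → P x → Path G P x x
  step : ∀ {x y z} → P x → adj G x y ≡ true → Path G P y z → Path G P x z

record MinorModel (H G : Graph) : Set₁ where
  field
    branch    : Fin (n H) → Fin (n G) → Set
    nonempty  : ∀ u → ∃ λ x → branch u x
    disjoint  : ∀ u v x → branch u x → branch v x → u ≡ v
    connected : ∀ u x y → branch u x → branch u y → Path G (branch u) x y
    edges     : ∀ u v → adj H u v ≡ true →
                ∃₂ λ x y → branch u x × branch v y × adj G x y ≡ true

infix 4 _≤m_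
_≤m_ : Graph → Graph → Set₁
H ≤m G = MinorModel H G

excl : Graph → Graph → Set₁
excl Z G = ¬ (Z ≤m G)

adj⊎ : {a b : ℕ} (A : Fin a → Fin a → Bool) (B : Fin b → Fin b → Bool) →
       Fin a ⊎ Fin b → Fin a ⊎ Fin b → Bool
adj⊎ A B (inj₁ x) (inj₁ y) = A x y
adj⊎ A B (inj₁ x) (inj₂ y) = false
adj⊎ A B (inj₂ x) (inj₁ y) = false
adj⊎ A B (inj₂ x) (inj₂ y) = B x y

adj⊎-sym : {a b : ℕ} (A : Fin a → Fin a → Bool) (B : Fin b → Fin b → Bool) →
           (∀ x y → A x y ≡ A y x) → (∀ x y → B x y ≡ B y x) →
           ∀ p q → adj⊎ A B p q ≡ adj⊎ A B q p
adj⊎-sym A B sA sB (inj₁ x) (inj₁ y) = sA x y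
adj⊎-sym A B sA sB (inj₁ x) (inj₂ y) = refl
adj⊎-sym A B sA sB (inj₂ x) (inj₁ y) = refl
adj⊎-sym A B sA sB (inj₂ x) (inj₂ y) = sB x y

adj⊎-irr : {a b : ℕ} (A : Fin a → Fin a → Bool) (B : Fin b → Fin b → Bool) →
           (∀ x → A x x ≡ false) → (∀ x → B x x ≡ false) →
           ∀ p → adj⊎ A B p p ≡ false
adj⊎-irr A B iA iB (inj₁ x) = iA x
adj⊎-irr A B iA iB (inj₂ x) = iB x

infixl 6 _⊕_
_⊕_ : Graph → Graph → Graph
G₁ ⊕ G₂ = record
  { n = n G₁ + n G₂
  ; adj = λ x y → adj⊎ (adj G₁) (adj G₂) (splitAt (n G₁) x) (splitAt (n G₁) y)
  ; sym-adj = λ x y → adj⊎-sym (adj G₁) (adj G₂) (sym-adj G₁) (sym-adj G₂)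
                        (splitAt (n G₁) x) (splitAt (n G₁) y)
  ; irr-adj = λ x → adj⊎-irr (adj G₁) (adj G₂) (irr-adj G₁) (irr-adj G₂)
                      (splitAt (n G₁) x)
  }

-- Vertex deletion G - S, S ⊆ V(G) given as a Subset (Vec Bool).
-- G - S is the subgraph induced by the complement of S, whose vertices
-- are enumerated in increasing order.

card : ∀ {m} → Subset m → ℕ
card []          = 0
card (true ∷ p)  = suc (card p)
card (false ∷ p) = card p

emb : ∀ {m} (p : Subset m) → Fin (card p) → Fin m
emb (true ∷ p)  zero    = zero
emb (true ∷ p)  (suc i) = suc (emb p i)
emb (false ∷ p) i       = suc (emb p i)

induced : (G : Graph) → Subset (n G) → Graph
induced G K = record
  { n = card K
  ; adj = λ i j → adj G (emb K i) (emb K j)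
  ; sym-adj = λ i j → sym-adj G (emb K i) (emb K j)
  ; irr-adj = λ i → irr-adj G (emb K i)
  }

infixl 5 _-_
_-_ : (G : Graph) → Subset (n G) → Graph
G - S = induced G (∁ S)

ApexIs : Graph → Graph → ℕ → Set₁
ApexIs Z G k =
  (Σ (Subset (n G)) λ S → ∣ S ∣ ≡ k × excl Z (G - S)) ×
  (∀ (S : Subset (n G)) → excl Z (G - S) → k ≤ ∣ S ∣)

ApexLe : Graph → Graph → ℕ → Set₁
ApexLe Z G k = Σ (Subset (n G)) λ S → ∣ S ∣ ≤ k × excl Z (G - S)

record ParametricGraph : Set₁ where
  field
    seq  : ℕ → Graph
    mono : ∀ t → seq t ≤m seq (suc t)
open ParametricGraph public

record ParametricFamily : Set₂ where
  field
    Idx : Set₁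
    mem : Idx → ParametricGraph
open ParametricFamily public

PUB : ParametricFamily → Graph → ℕ → Set₁
PUB 𝔊 G u = ∀ (i : Idx 𝔊) (t : ℕ) → seq (mem 𝔊 i) t ≤m G → t ≤ u

-- p_𝔊(G) = t  (the maximum, i.e. the least upper bound in ℕ; 0 if empty)
PIs : ParametricFamily → Graph → ℕ → Set₁
PIs 𝔊 G t = PUB 𝔊 G t × (∀ u → PUB 𝔊 G u → t ≤ u)

Obstructing : ParametricFamily → Graph → (ℕ → ℕ) → Set₁
Obstructing 𝔊 Z f =
  (∀ (G : Graph) (k : ℕ) → ApexIs Z G k → PUB 𝔊 G (f k)) ×
  (∀ (G : Graph) (t : ℕ) → PIs 𝔊 G t → ApexLe Z G (f t))

module _ where
  lift-path : (G G' : Graph) (P : Fin (n G) → Set) (Q : Fin (n G') → Set)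
              (φ : Fin (n G) → Fin (n G')) →
              (∀ x y → adj G x y ≡ true → adj G' (φ x) (φ y) ≡ true) →
              (∀ x → P x → Q (φ x)) →
              ∀ {x y} → Path G P x y → Path G' Q (φ x) (φ y)
  lift-path G G' P Q φ h p (here px) = here (p _ px)
  lift-path G G' P Q φ h p (step px e r) =
    step (p _ px) (h _ _ e) (lift-path G G' P Q φ h p r)

  module SumModel (H₁ H₂ G₁ G₂ : Graph) (M₁ : H₁ ≤m G₁) (M₂ : H₂ ≤m G₂) where
    module M₁ = MinorModel M₁
    module M₂ = MinorModel M₂
    h₁ = n H₁ ; h₂ = n H₂ ; g₁ = n G₁ ; g₂ = n G₂

    B : Fin (h₁ + h₂) → Fin (g₁ + g₂) → Set
    B u x =
      (Σ (Fin h₁) λ a → Σ (Fin g₁) λ b →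
         splitAt h₁ u ≡ inj₁ a × splitAt g₁ x ≡ inj₁ b × M₁.branch a b) ⊎
      (Σ (Fin h₂) λ a → Σ (Fin g₂) λ b →
         splitAt h₁ u ≡ inj₂ a × splitAt g₁ x ≡ inj₂ b × M₂.branch a b)

    hl : ∀ x y → adj G₁ x y ≡ true →
         adj (G₁ ⊕ G₂) (x ↑ˡ g₂) (y ↑ˡ g₂) ≡ true
    hl x y e rewrite splitAt-↑ˡ g₁ x g₂ | splitAt-↑ˡ g₁ y g₂ = e

    hr : ∀ x y → adj G₂ x y ≡ true →
         adj (G₁ ⊕ G₂) (g₁ ↑ʳ x) (g₁ ↑ʳ y) ≡ true
    hr x y e rewrite splitAt-↑ʳ g₁ g₂ x | splitAt-↑ʳ g₁ g₂ y = e

    ne' : ∀ u (su : Fin h₁ ⊎ Fin h₂) → splitAt h₁ u ≡ su → ∃ λ x → B u x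
    ne' u (inj₁ a) eq with M₁.nonempty a
    ... | x , bx = x ↑ˡ g₂ , inj₁ (a , x , eq , splitAt-↑ˡ g₁ x g₂ , bx)
    ne' u (inj₂ a) eq with M₂.nonempty a
    ... | x , bx = g₁ ↑ʳ x , inj₂ (a , x , eq , splitAt-↑ʳ g₁ g₂ x , bx)

    ne : ∀ u → ∃ λ x → B u x
    ne u = ne' u (splitAt h₁ u) refl

    inj₁≢inj₂ : ∀ {A C : Set} {a : A} {c : C} → inj₁ a ≡ inj₂ c → ⊥
    inj₁≢inj₂ ()

    dj : ∀ u v x → B u x → B v x → u ≡ v
    dj u v x (inj₁ (a , b , ea , eb , p)) (inj₁ (a' , b' , ea' , eb' , p'))
      with inj₁-injective (trans (sym eb) eb')
    ... | refl with M₁.disjoint a a' b p p'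
    ...   | refl = trans (sym (splitAt⁻¹-↑ˡ ea)) (splitAt⁻¹-↑ˡ ea')
    dj u v x (inj₁ (a , b , ea , eb , p)) (inj₂ (a' , b' , ea' , eb' , p')) =
      ⊥-elim (inj₁≢inj₂ (trans (sym eb) eb'))
    dj u v x (inj₂ (a , b , ea , eb , p)) (inj₁ (a' , b' , ea' , eb' , p')) =
      ⊥-elim (inj₁≢inj₂ (trans (sym eb') eb))
    dj u v x (inj₂ (a , b , ea , eb , p)) (inj₂ (a' , b' , ea' , eb' , p'))
      with inj₂-injective (trans (sym eb) eb')
    ... | refl with M₂.disjoint a a' b p p'
    ...   | refl = trans (sym (splitAt⁻¹-↑ʳ ea)) (splitAt⁻¹-↑ʳ ea')

    cn : ∀ u x y → B u x → B u y → Path (G₁ ⊕ G₂) (B u) x y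
    cn u x y (inj₁ (a , b , ea , eb , p)) (inj₁ (a' , c , ea' , ec , q))
      with inj₁-injective (trans (sym ea) ea')
    ... | refl =
      subst (λ z → Path (G₁ ⊕ G₂) (B u) z y) (splitAt⁻¹-↑ˡ eb)
        (subst (λ z → Path (G₁ ⊕ G₂) (B u) (b ↑ˡ g₂) z) (splitAt⁻¹-↑ˡ ec)
          (lift-path G₁ (G₁ ⊕ G₂) (M₁.branch a) (B u) (_↑ˡ g₂) hl
            (λ z bz → inj₁ (a , z , ea , splitAt-↑ˡ g₁ z g₂ , bz))
            (M₁.connected a b c p q)))
    cn u x y (inj₁ (a , b , ea , eb , p)) (inj₂ (a' , c , ea' , ec , q)) =
      ⊥-elim (inj₁≢inj₂ (trans (sym ea) ea'))
    cn u x y (inj₂ (a , b , ea , eb , p)) (inj₁ (a' , c , ea' , ec , q)) =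
      ⊥-elim (inj₁≢inj₂ (trans (sym ea') ea))
    cn u x y (inj₂ (a , b , ea , eb , p)) (inj₂ (a' , c , ea' , ec , q))
      with inj₂-injective (trans (sym ea) ea')
    ... | refl =
      subst (λ z → Path (G₁ ⊕ G₂) (B u) z y) (splitAt⁻¹-↑ʳ eb)
        (subst (λ z → Path (G₁ ⊕ G₂) (B u) (g₁ ↑ʳ b) z) (splitAt⁻¹-↑ʳ ec)
          (lift-path G₂ (G₁ ⊕ G₂) (M₂.branch a) (B u) (g₁ ↑ʳ_) hr
            (λ z bz → inj₂ (a , z , ea , splitAt-↑ʳ g₁ g₂ z , bz))
            (M₂.connected a b c p q)))

    ed' : ∀ u v (su sv : Fin h₁ ⊎ Fin h₂) → splitAt h₁ u ≡ su → splitAt h₁ v ≡ sv →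
          adj⊎ (adj H₁) (adj H₂) su sv ≡ true →
          ∃₂ λ x y → B u x × B v y × adj (G₁ ⊕ G₂) x y ≡ true
    ed' u v (inj₁ a) (inj₁ b) eu ev e with M₁.edges a b e
    ... | x , y , bx , by , exy =
      x ↑ˡ g₂ , y ↑ˡ g₂ ,
      inj₁ (a , x , eu , splitAt-↑ˡ g₁ x g₂ , bx) ,
      inj₁ (b , y , ev , splitAt-↑ˡ g₁ y g₂ , by) , hl x y exy
    ed' u v (inj₂ a) (inj₂ b) eu ev e with M₂.edges a b e
    ... | x , y , bx , by , exy =
      g₁ ↑ʳ x , g₁ ↑ʳ y ,
      inj₂ (a , x , eu , splitAt-↑ʳ g₁ g₂ x , bx) ,
      inj₂ (b , y , ev , splitAt-↑ʳ g₁ g₂ y , by) , hr x y exy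
    ed' u v (inj₁ a) (inj₂ b) eu ev ()
    ed' u v (inj₂ a) (inj₁ b) eu ev ()

    model : (H₁ ⊕ H₂) ≤m (G₁ ⊕ G₂)
    model = record
      { branch = B ; nonempty = ne ; disjoint = dj ; connected = cn
      ; edges = λ u v e → ed' u v (splitAt h₁ u) (splitAt h₁ v) refl refl e }

⊕-mono : ∀ {H₁ H₂ G₁ G₂} → H₁ ≤m G₁ → H₂ ≤m G₂ → (H₁ ⊕ H₂) ≤m (G₁ ⊕ G₂)
⊕-mono {H₁} {H₂} {G₁} {G₂} M₁ M₂ = SumModel.model H₁ H₂ G₁ G₂ M₁ M₂

_⊕P_ : ParametricGraph → ParametricGraph → ParametricGraph
𝒢 ⊕P 𝒢' = record
  { seq  = λ t → seq 𝒢 t ⊕ seq 𝒢' t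
  ; mono = λ t → ⊕-mono (mono 𝒢 t) (mono 𝒢' t) }

_⊗_ : ParametricFamily → ParametricFamily → ParametricFamily
𝔊 ⊗ 𝔊' = record
  { Idx = Idx 𝔊 × Idx 𝔊'
  ; mem = λ { (i , j) → mem 𝔊 i ⊕P mem 𝔊' j } }

{-# OPTIONS --safe #-}
-- Let H₁ + H₂ be a minor of G and S a set of k vertices with Z₁ + Z₂ not a
-- minor of G − S. Let Sᵢ be the set of vertices of Hᵢ whose branch sets meet
-- S, so |Sᵢ| ≤ k. Models of Z₁ in H₁ − S₁ and of Z₂ in H₂ − S₂ would lift to
-- disjoint models in G − S, hence a model of Z₁ + Z₂ there; so
-- apex_{excl(Zᵢ)}(Hᵢ) ≤ k for some i. If Hᵢ = 𝔉ⁱ_t, the obstruction bound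
-- p_{𝔉ⁱ}(Hᵢ) ≤ f(apex) gives t ≤ max_{a ≤ k} f(a).
--
-- Branch sets are arbitrary predicates, so minor containment is undecidable
-- and the case analysis runs in the double-negation monad; the conclusion,
-- an inequality of naturals, is stable.
module Submission where

open import Defs
open import Data.Nat using (ℕ)
open import Data.Product using (Σ)

open import Level using (Level)
open import Function using (_∘_; id; Injective)
open import Data.Bool using (true)
open import Data.Empty using (⊥; ⊥-elim)
open import Data.Maybe using (Maybe; just; nothing; maybe′)
open import Data.Nat using (zero; suc; _+_; _≤_; _<_; _⊔_; z≤n; s≤s; _≤?_)
open import Data.Nat.Induction using (<-rec)
open import Data.Nat.Properties
  using (≤-refl; ≤-trans; ≤-reflexive; ≮⇒≥; +-mono-≤; +-monoʳ-≤; +-suc; n≤1+n;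
         m≤n⇒m<n∨m≡n; m≤n⇒m≤n⊔o; m≤n⇒m≤o⊔n)
open import Data.Fin using (Fin; zero; suc; splitAt; join; _↑ˡ_; _↑ʳ_)
open import Data.Fin.Properties
  using (suc-injective; ↑ˡ-injective; ↑ʳ-injective; splitAt-↑ˡ; splitAt-↑ʳ; join-splitAt)
open import Data.Fin.Subset using (Subset; inside; outside; _∈_; ∣_∣; ∁; _∪_; ⁅_⁆)
  renaming (⊥ to ∅)
open import Data.Fin.Subset.Properties
  using (∣⊥∣≡0; ∣⁅x⁆∣≡1; x∈⁅x⁆; x∈p∪q⁺; x∈∁p⇒x∉p; x∉p⇒x∈∁p)
open import Data.Vec using (_∷_; []; here; there)
open import Data.Product using (∃; ∃₂; _×_; _,_; proj₁; proj₂)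
import Data.Product as Product
open import Data.Sum using (_⊎_; inj₁; inj₂; [_,_])
open import Relation.Nullary using (¬_; Dec; yes; no)
open import Relation.Nullary.Decidable using (¬¬-excluded-middle; decidable-stable)
open import Relation.Nullary.Negation using (contradiction; negated-stable; ¬¬-map)
open import Relation.Binary.PropositionalEquality
  using (_≡_; _≢_; refl; sym; trans; cong; cong₂; subst; module ≡-Reasoning)

private variable
  a b ℓ : Level
  A : Set a
  B : Set b
  m h k t : ℕ
  Z Z₁ Z₂ H H₁ H₂ G : Graph

-- The library's ¬¬-Monad lives at a single level, but here minor models
-- (in Set₁) and inequalities of ℕ (in Set) meet in one computation.
pure : A → ¬ ¬ A
pure = contradiction

_>>=_ : ¬ ¬ A → (A → ¬ ¬ B) → ¬ ¬ B
x >>= f = negated-stable (¬¬-map f x)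

¬¬-Fin-choice : {P : Fin m → Set ℓ} → (∀ i → ¬ ¬ P i) → ¬ ¬ (∀ i → P i)
¬¬-Fin-choice {zero}  _ = pure λ ()
¬¬-Fin-choice {suc m} p = do
  p₀ ← p zero
  ps ← ¬¬-Fin-choice (p ∘ suc)
  pure λ { zero → p₀ ; (suc i) → ps i }

Least : (ℕ → Set ℓ) → ℕ → Set ℓ
Least P m = P m × ∀ {k} → P k → m ≤ k

¬¬-least : (P : ℕ → Set ℓ) → ∀ n → P n → ¬ ¬ ∃ (Least P)
¬¬-least P = <-rec (λ n → P n → ¬ ¬ ∃ (Least P)) descend
  where
  descend : ∀ n → (∀ {k} → k < n → P k → ¬ ¬ ∃ (Least P)) → P n → ¬ ¬ ∃ (Least P)
  descend n below pn = do
    yes (k , k<n , pk) ← ¬¬-excluded-middle {A = ∃ λ k → k < n × P k}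
      where no ∄k → pure (n , pn , λ {k} pk → ≮⇒≥ λ k<n → ∄k (_ , k<n , pk))
    below k<n pk

maxUpTo : (ℕ → ℕ) → ℕ → ℕ
maxUpTo f zero    = f zero
maxUpTo f (suc k) = maxUpTo f k ⊔ f (suc k)

f≤maxUpTo : ∀ f {a} k → a ≤ k → f a ≤ maxUpTo f k
f≤maxUpTo f zero    z≤n = ≤-refl
f≤maxUpTo f (suc k) a≤1+k with m≤n⇒m<n∨m≡n a≤1+k
... | inj₁ (s≤s a≤k) = m≤n⇒m≤n⊔o (f (suc k)) (f≤maxUpTo f k a≤k)
... | inj₂ refl      = m≤n⇒m≤o⊔n (maxUpTo f k) ≤-refl

image : (Fin m → Maybe (Fin h)) → Subset m → Subset h
image φ []            = ∅
image φ (inside ∷ S)  = maybe′ ⁅_⁆ ∅ (φ zero) ∪ image (φ ∘ suc) S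
image φ (outside ∷ S) = image (φ ∘ suc) S

∣p∪q∣≤∣p∣+∣q∣ : (p q : Subset m) → ∣ p ∪ q ∣ ≤ ∣ p ∣ + ∣ q ∣
∣p∪q∣≤∣p∣+∣q∣ []            []            = z≤n
∣p∪q∣≤∣p∣+∣q∣ (inside ∷ p)  (inside ∷ q)  =
  s≤s (≤-trans (∣p∪q∣≤∣p∣+∣q∣ p q) (+-monoʳ-≤ ∣ p ∣ (n≤1+n ∣ q ∣)))
∣p∪q∣≤∣p∣+∣q∣ (inside ∷ p)  (outside ∷ q) = s≤s (∣p∪q∣≤∣p∣+∣q∣ p q)
∣p∪q∣≤∣p∣+∣q∣ (outside ∷ p) (inside ∷ q)  =
  ≤-trans (s≤s (∣p∪q∣≤∣p∣+∣q∣ p q)) (≤-reflexive (sym (+-suc ∣ p ∣ ∣ q ∣)))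
∣p∪q∣≤∣p∣+∣q∣ (outside ∷ p) (outside ∷ q) = ∣p∪q∣≤∣p∣+∣q∣ p q

∣maybe⁅x⁆∣≤1 : (x : Maybe (Fin h)) → ∣ maybe′ ⁅_⁆ ∅ x ∣ ≤ 1
∣maybe⁅x⁆∣≤1 {h} nothing = ≤-trans (≤-reflexive (∣⊥∣≡0 h)) z≤n
∣maybe⁅x⁆∣≤1 (just x)    = ≤-reflexive (∣⁅x⁆∣≡1 x)

∣image∣≤∣S∣ : (φ : Fin m → Maybe (Fin h)) (S : Subset m) → ∣ image φ S ∣ ≤ ∣ S ∣
∣image∣≤∣S∣ {h = h} φ [] = ≤-reflexive (∣⊥∣≡0 h)
∣image∣≤∣S∣ φ (inside ∷ S) =
  ≤-trans (∣p∪q∣≤∣p∣+∣q∣ (maybe′ ⁅_⁆ ∅ (φ zero)) (image (φ ∘ suc) S))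
          (+-mono-≤ (∣maybe⁅x⁆∣≤1 (φ zero)) (∣image∣≤∣S∣ (φ ∘ suc) S))
∣image∣≤∣S∣ φ (outside ∷ S) = ∣image∣≤∣S∣ (φ ∘ suc) S

∈-image : ∀ (φ : Fin m → Maybe (Fin h)) {S y x} → y ∈ S → φ y ≡ just x → x ∈ image φ S
∈-image φ {inside ∷ S} {x = x} here φy≡x =
  x∈p∪q⁺ (inj₁ (subst (λ z → x ∈ maybe′ ⁅_⁆ ∅ z) (sym φy≡x) (x∈⁅x⁆ x)))
∈-image φ {inside ∷ S}  (there y∈S) φy≡x = x∈p∪q⁺ (inj₂ (∈-image (φ ∘ suc) y∈S φy≡x))
∈-image φ {outside ∷ S} (there y∈S) φy≡x = ∈-image (φ ∘ suc) y∈S φy≡x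

emb-∈ : (K : Subset m) (i : Fin (card K)) → emb K i ∈ K
emb-∈ (inside ∷ K)  zero    = here
emb-∈ (inside ∷ K)  (suc i) = there (emb-∈ K i)
emb-∈ (outside ∷ K) i       = there (emb-∈ K i)

emb-surjective : (K : Subset m) {x : Fin m} → x ∈ K → ∃ λ i → emb K i ≡ x
emb-surjective (inside ∷ K)  here        = zero , refl
emb-surjective (inside ∷ K)  (there x∈K) = Product.map suc (cong suc) (emb-surjective K x∈K)
emb-surjective (outside ∷ K) (there x∈K) = Product.map id (cong suc) (emb-surjective K x∈K)

emb-injective : (K : Subset m) → Injective _≡_ _≡_ (emb K)
emb-injective (inside ∷ K)  {zero}  {zero}  _  = refl
emb-injective (inside ∷ K)  {zero}  {suc j} ()
emb-injective (inside ∷ K)  {suc i} {zero}  ()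
emb-injective (inside ∷ K)  {suc i} {suc j} eq = cong suc (emb-injective K (suc-injective eq))
emb-injective (outside ∷ K) eq = emb-injective K (suc-injective eq)

module _ {G : Graph} {P : Fin (n G) → Set} where

  Path-head : ∀ {x y} → Path G P x y → P x
  Path-head (here px)     = px
  Path-head (step px _ _) = px

  _++ₚ_ : ∀ {x y z} → Path G P x y → Path G P y z → Path G P x z
  here _        ++ₚ q = q
  step px xy p  ++ₚ q = step px xy (p ++ₚ q)

open MinorModel

Supported : Z ≤m G → (Fin (n G) → Set) → Set
Supported M P = ∀ u y → branch M u y → P y

embedding-≤m : (φ : Fin (n H) → Fin (n G)) → Injective _≡_ _≡_ φ →
               (∀ x y → adj H x y ≡ true → adj G (φ x) (φ y) ≡ true) → H ≤m G
embedding-≤m φ φ-injective φ-adj = record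
  { branch    = λ u x → φ u ≡ x
  ; nonempty  = λ u → φ u , refl
  ; disjoint  = λ { u v _ refl φv≡φu → sym (φ-injective φv≡φu) }
  ; connected = λ { u _ _ refl refl → here refl }
  ; edges     = λ u v uv → φ u , φ v , refl , refl , φ-adj u v uv
  }

≤m-refl : H ≤m H
≤m-refl = embedding-≤m id id (λ _ _ xy → xy)

induced-≤m : (K : Subset (n G)) → induced G K ≤m G
induced-≤m K = embedding-≤m (emb K) (emb-injective K) (λ _ _ xy → xy)

adj-↑ˡ : ∀ H₁ H₂ x y → adj (H₁ ⊕ H₂) (x ↑ˡ n H₂) (y ↑ˡ n H₂) ≡ adj H₁ x y
adj-↑ˡ H₁ H₂ x y = cong₂ (adj⊎ (adj H₁) (adj H₂))
  (splitAt-↑ˡ (n H₁) x (n H₂)) (splitAt-↑ˡ (n H₁) y (n H₂))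

adj-↑ʳ : ∀ H₁ H₂ x y → adj (H₁ ⊕ H₂) (n H₁ ↑ʳ x) (n H₁ ↑ʳ y) ≡ adj H₂ x y
adj-↑ʳ H₁ H₂ x y = cong₂ (adj⊎ (adj H₁) (adj H₂))
  (splitAt-↑ʳ (n H₁) (n H₂) x) (splitAt-↑ʳ (n H₁) (n H₂) y)

⊕-inj₁-≤m : ∀ {H₁ H₂} → H₁ ≤m H₁ ⊕ H₂
⊕-inj₁-≤m {H₁} {H₂} = embedding-≤m (_↑ˡ n H₂) (↑ˡ-injective (n H₂) _ _)
  (λ x y xy → trans (adj-↑ˡ H₁ H₂ x y) xy)

⊕-inj₂-≤m : ∀ {H₁ H₂} → H₂ ≤m H₁ ⊕ H₂
⊕-inj₂-≤m {H₁} {H₂} = embedding-≤m (n H₁ ↑ʳ_) (↑ʳ-injective (n H₁) _ _)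
  (λ x y xy → trans (adj-↑ʳ H₁ H₂ x y) xy)

↑ˡ≢↑ʳ : (i : Fin m) (j : Fin h) → i ↑ˡ h ≢ m ↑ʳ j
↑ˡ≢↑ʳ {m} {h} i j eq
  with () ← trans (sym (splitAt-↑ˡ m i h)) (trans (cong (splitAt m) eq) (splitAt-↑ʳ m h j))

splitAt-injective : ∀ m {h} {i j : Fin (m + h)} → splitAt m i ≡ splitAt m j → i ≡ j
splitAt-injective m {h} {i} {j} eq = begin
  i                      ≡⟨ join-splitAt m h i ⟨
  join m h (splitAt m i) ≡⟨ cong (join m h) eq ⟩
  join m h (splitAt m j) ≡⟨ join-splitAt m h j ⟩
  j                      ∎
  where open ≡-Reasoning

≤m-trans : Z ≤m H → H ≤m G → Z ≤m G
≤m-trans {Z} {H} {G} M N = record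
  { branch    = Branch
  ; nonempty  = λ u → let (x , bx) = nonempty M u ; (y , by) = nonempty N x in y , x , bx , by
  ; disjoint  = apart
  ; connected = λ { u y y′ (x , bx , by) (x′ , bx′ , by′) →
                      connect (connected M u x x′ bx bx′) by by′ }
  ; edges     = crossEdge
  }
  where
  Branch : Fin (n Z) → Fin (n G) → Set
  Branch u y = ∃ λ x → branch M u x × branch N x y

  apart : ∀ u v y → Branch u y → Branch v y → u ≡ v
  apart u v y (x , bx , by) (x′ , bx′ , by′) with disjoint N x x′ y by by′
  ... | refl = disjoint M u v x bx bx′

  within : ∀ {u x} → branch M u x → ∀ {y y′} → Path G (branch N x) y y′ → Path G (Branch u) y y′
  within {x = x} bx = lift-path G G _ _ id (λ _ _ yy′ → yy′) (λ y by → x , bx , by)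

  -- A path through the branch sets of M is expanded into a path of G
  -- by routing through each branch set of N it visits.
  connect : ∀ {u x x′} → Path H (branch M u) x x′ →
            ∀ {y y′} → branch N x y → branch N x′ y′ → Path G (Branch u) y y′
  connect {x = x} (here bx) by by′ = within bx (connected N x _ _ by by′)
  connect {x = x} (step {y = x″} bx xx″ p) by by′ with edges N x x″ xx″
  ... | z , z″ , bz , bz″ , zz″ =
    within bx (connected N x _ _ by bz) ++ₚ step (x , bx , bz) zz″ (connect p bz″ by′)

  crossEdge : ∀ u v → adj Z u v ≡ true →
              ∃₂ λ y y′ → Branch u y × Branch v y′ × adj G y y′ ≡ true
  crossEdge u v uv with edges M u v uv
  ... | x , x′ , bx , bx′ , xx′ with edges N x x′ xx′
  ...   | y , y′ , by , by′ , yy′ = y , y′ , (x , bx , by) , (x′ , bx′ , by′) , yy′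

≤m-induced : (K : Subset (n G)) (M : Z ≤m G) → Supported M (_∈ K) → Z ≤m induced G K
≤m-induced {G} {Z} K M M⊆K = record
  { branch    = λ u i → branch M u (emb K i)
  ; nonempty  = λ u → let (y , by) = nonempty M u in pullback u by
  ; disjoint  = λ u v i → disjoint M u v (emb K i)
  ; connected = λ u i j bi bj → pull (connected M u _ _ bi bj) refl refl
  ; edges     = crossEdge
  }
  where
  pullback : ∀ u {y} → branch M u y → ∃ λ i → branch M u (emb K i)
  pullback u {y} by with emb-surjective K (M⊆K u y by)
  ... | i , refl = i , by

  pull : ∀ {u x y i j} → Path G (branch M u) x y → emb K i ≡ x → emb K j ≡ y →
         Path (induced G K) (branch M u ∘ emb K) i j
  pull (here bx) refl ji with emb-injective K ji
  ... | refl = here bx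
  pull {u} (step {y = x′} bx xx′ p) refl ej with emb-surjective K (M⊆K u x′ (Path-head p))
  ... | i′ , refl = step bx xx′ (pull p refl ej)

  crossEdge : ∀ u v → adj Z u v ≡ true →
              ∃₂ λ i j → branch M u (emb K i) × branch M v (emb K j) ×
                         adj G (emb K i) (emb K j) ≡ true
  crossEdge u v uv with edges M u v uv
  ... | x , y , bx , by , xy with emb-surjective K (M⊆K u x bx) | emb-surjective K (M⊆K v y by)
  ...   | i , refl | j , refl = i , j , bx , by , xy

⊕-join : (M₁ : Z₁ ≤m G) (M₂ : Z₂ ≤m G) →
         (∀ a b y → branch M₁ a y → branch M₂ b y → ⊥) → Z₁ ⊕ Z₂ ≤m G
⊕-join {Z₁} {G} {Z₂} M₁ M₂ M₁#M₂ = record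
  { branch    = Branch ∘ splitAt (n Z₁)
  ; nonempty  = nonempty′ ∘ splitAt (n Z₁)
  ; disjoint  = λ u v y bu bv →
      splitAt-injective (n Z₁) (apart (splitAt (n Z₁) u) (splitAt (n Z₁) v) y bu bv)
  ; connected = connected′ ∘ splitAt (n Z₁)
  ; edges     = λ u v → crossEdge (splitAt (n Z₁) u) (splitAt (n Z₁) v)
  }
  where
  Branch : Fin (n Z₁) ⊎ Fin (n Z₂) → Fin (n G) → Set
  Branch = [ branch M₁ , branch M₂ ]

  nonempty′ : ∀ s → ∃ (Branch s)
  nonempty′ (inj₁ a) = nonempty M₁ a
  nonempty′ (inj₂ b) = nonempty M₂ b

  apart : ∀ s s′ y → Branch s y → Branch s′ y → s ≡ s′
  apart (inj₁ a) (inj₁ a′) y ba ba′ = cong inj₁ (disjoint M₁ a a′ y ba ba′)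
  apart (inj₁ a) (inj₂ b)  y ba bb  = ⊥-elim (M₁#M₂ a b y ba bb)
  apart (inj₂ b) (inj₁ a)  y bb ba  = ⊥-elim (M₁#M₂ a b y ba bb)
  apart (inj₂ b) (inj₂ b′) y bb bb′ = cong inj₂ (disjoint M₂ b b′ y bb bb′)

  connected′ : ∀ s x y → Branch s x → Branch s y → Path G (Branch s) x y
  connected′ (inj₁ a) = connected M₁ a
  connected′ (inj₂ b) = connected M₂ b

  crossEdge : ∀ s s′ → adj⊎ (adj Z₁) (adj Z₂) s s′ ≡ true →
              ∃₂ λ x y → Branch s x × Branch s′ y × adj G x y ≡ true
  crossEdge (inj₁ a) (inj₁ a′) = edges M₁ a a′
  crossEdge (inj₂ b) (inj₂ b′) = edges M₂ b b′
  crossEdge (inj₁ a) (inj₂ b)  ()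
  crossEdge (inj₂ b) (inj₁ a)  ()

-- φ names, for every vertex of G lying in a branch set of N, the vertex of H
-- owning that branch set; image φ S is then the set of vertices of H whose
-- branch sets meet S.
BranchIndex : H ≤m G → (Fin (n G) → Maybe (Fin (n H))) → Set
BranchIndex N φ = ∀ a y → branch N a y → φ y ≡ just a

¬¬-branchIndex : (N : H ≤m G) → ¬ ¬ Σ (Fin (n G) → Maybe (Fin (n H))) (BranchIndex N)
¬¬-branchIndex {H} {G} N = do
  owner? ← ¬¬-Fin-choice (λ y → ¬¬-excluded-middle {A = ∃ λ a → branch N a y})
  pure ((λ y → owner (owner? y)) , λ a y bay → index (owner? y) bay)
  where
  owner : ∀ {y} → Dec (∃ λ a → branch N a y) → Maybe (Fin (n H))
  owner (yes (a , _)) = just a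
  owner (no _)        = nothing

  index : ∀ {a y} (owner? : Dec (∃ λ a → branch N a y)) → branch N a y → owner owner? ≡ just a
  index (yes (a′ , ba′y)) bay = cong just (disjoint N a′ _ _ ba′y bay)
  index (no ∄a)           bay = ⊥-elim (∄a (_ , bay))

≤m-lift-avoiding : (N : H ≤m G) {φ : Fin (n G) → Maybe (Fin (n H))} → BranchIndex N φ →
                   (S : Subset (n G)) → Z ≤m H - image φ S →
                   Σ (Z ≤m G) λ A → Supported A (λ y → y ∈ ∁ S × ∃ λ a → branch N a y)
≤m-lift-avoiding {H} {G} {Z} N {φ} index S M = lifted , avoids
  where
  K : Subset (n H)
  K = ∁ (image φ S)

  lifted : Z ≤m G
  lifted = ≤m-trans (≤m-trans M (induced-≤m K)) N

  avoids : Supported lifted (λ y → y ∈ ∁ S × ∃ λ a → branch N a y)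
  avoids u y (_ , (i , _ , refl) , bxy) =
    x∉p⇒x∈∁p (λ y∈S → x∈∁p⇒x∉p (emb-∈ K i) (∈-image φ y∈S (index _ y bxy))) , emb K i , bxy

module _ {H₁ H₂ G : Graph} (N : H₁ ⊕ H₂ ≤m G) where

  private
    N₁ : H₁ ≤m G
    N₁ = ≤m-trans ⊕-inj₁-≤m N

    N₂ : H₂ ≤m G
    N₂ = ≤m-trans ⊕-inj₂-≤m N

    N₁#N₂ : ∀ a b y → branch N₁ a y → branch N₂ b y → ⊥
    N₁#N₂ a b y (_ , refl , bay) (_ , refl , bby) = ↑ˡ≢↑ʳ a b (disjoint N _ _ y bay bby)

  ⊕-≤m-avoiding : (S : Subset (n G)) →
                  {φ₁ : Fin (n G) → Maybe (Fin (n H₁))} → BranchIndex N₁ φ₁ →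
                  {φ₂ : Fin (n G) → Maybe (Fin (n H₂))} → BranchIndex N₂ φ₂ →
                  Z₁ ≤m H₁ - image φ₁ S → Z₂ ≤m H₂ - image φ₂ S → Z₁ ⊕ Z₂ ≤m G - S
  ⊕-≤m-avoiding S index₁ index₂ M₁ M₂
    with (A₁ , A₁-avoids) ← ≤m-lift-avoiding N₁ index₁ S M₁
       | (A₂ , A₂-avoids) ← ≤m-lift-avoiding N₂ index₂ S M₂
    = ⊕-join (≤m-induced {G} (∁ S) A₁ λ u y → proj₁ ∘ A₁-avoids u y)
             (≤m-induced {G} (∁ S) A₂ λ u y → proj₁ ∘ A₂-avoids u y)
             λ a b _ ba bb → N₁#N₂ _ _ _ (proj₂ (proj₂ (A₁-avoids a _ ba)))
                                          (proj₂ (proj₂ (A₂-avoids b _ bb)))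

  ⊕-apex-split : ApexLe (Z₁ ⊕ Z₂) G k → ¬ ¬ (ApexLe Z₁ H₁ k ⊎ ApexLe Z₂ H₂ k)
  ⊕-apex-split {Z₁} {Z₂} (S , ∣S∣≤k , G-S∌Z) = do
    (φ₁ , index₁) ← ¬¬-branchIndex N₁
    (φ₂ , index₂) ← ¬¬-branchIndex N₂
    yes M₁ ← ¬¬-excluded-middle {A = Z₁ ≤m H₁ - image φ₁ S}
      where no H₁∌Z₁ → pure (inj₁ (image φ₁ S , ≤-trans (∣image∣≤∣S∣ φ₁ S) ∣S∣≤k , H₁∌Z₁))
    pure (inj₂ (image φ₂ S , ≤-trans (∣image∣≤∣S∣ φ₂ S) ∣S∣≤k ,
                λ M₂ → G-S∌Z (⊕-≤m-avoiding S index₁ index₂ M₁ M₂)))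

¬¬-apexIs : ApexLe Z G k → ¬ ¬ ∃ λ a → a ≤ k × ApexIs Z G a
¬¬-apexIs {Z} {G} (S , ∣S∣≤k , G-S∌Z) = do
  (a , (S′ , ∣S′∣≡a , G-S′∌Z) , minimal) ← ¬¬-least Deletion ∣ S ∣ (S , refl , G-S∌Z)
  pure (a , ≤-trans (minimal (S , refl , G-S∌Z)) ∣S∣≤k ,
        (S′ , ∣S′∣≡a , G-S′∌Z) , λ T G-T∌Z → minimal (T , refl , G-T∌Z))
  where
  Deletion : ℕ → Set₁
  Deletion a = Σ (Subset (n G)) λ S → ∣ S ∣ ≡ a × excl Z (G - S)

apexLe⇒index≤ : (𝔉 : ParametricFamily) (f : ℕ → ℕ) →
                (∀ G k → ApexIs Z G k → PUB 𝔉 G (f k)) →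
                ∀ i → ApexLe Z (seq (mem 𝔉 i) t) k → ¬ ¬ (t ≤ maxUpTo f k)
apexLe⇒index≤ {t = t} 𝔉 f p≤f[apex] i le = do
  (a , a≤k , apex≡a) ← ¬¬-apexIs {G = seq (mem 𝔉 i) t} le
  pure (≤-trans (p≤f[apex] _ a apex≡a i _ ≤m-refl) (f≤maxUpTo f _ a≤k))

lemma12p5 : (Z₁ Z₂ : Graph) (𝔉¹ 𝔉² : ParametricFamily) (f : ℕ → ℕ) →
            Obstructing 𝔉¹ Z₁ f → Obstructing 𝔉² Z₂ f →
            Σ (ℕ → ℕ) λ g → ∀ (G : Graph) (k : ℕ) →
              ApexIs (Z₁ ⊕ Z₂) G k → PUB (𝔉¹ ⊗ 𝔉²) G (g k)
lemma12p5 Z₁ Z₂ 𝔉¹ 𝔉² f (p₁≤f[apex₁] , _) (p₂≤f[apex₂] , _) = maxUpTo f , bound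
  where
  bound : ∀ G k → ApexIs (Z₁ ⊕ Z₂) G k → PUB (𝔉¹ ⊗ 𝔉²) G (maxUpTo f k)
  bound G k ((S , ∣S∣≡k , G-S∌Z) , _) (i , j) t N = decidable-stable (t ≤? maxUpTo f k) do
    side ← ⊕-apex-split N (S , ≤-reflexive ∣S∣≡k , G-S∌Z)
    [ apexLe⇒index≤ 𝔉¹ f p₁≤f[apex₁] i , apexLe⇒index≤ 𝔉² f p₂≤f[apex₂] j ] side
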